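{- Let $G_1,G_2,H$ be graphs with $V(G_1)=V(G_2)$, set $\mathbf G=(G_1,G_2)$, let $f:V(H)\to\{1,2\}$ be a non-constant map, and let $I$ be a graph with vertex set $V(G_1)\times V(H)$ containing $P=\mathbf G\mathbin{\underset{f}{\square}}H$ as a subgraph. Assume: (i) every cycle $C$ of $I$ whose length equals the odd girth of $I$ satisfies $|\pi_H(V(C))|=1$; (ii) $G_1$ and $G_2$ have the same odd girth, and for each $i\in\{1,2\}$ the union of the cycles of $G_i$ of length equal to the odd girth of $G_i$ is a spanning connected subgraph of $G_i$; (iii) for every edge $e\in E(I)\setminus E(P)$, $|\pi_H(e)|=2$ and $\pi_H(e)\notin E(H)$; (iv) there is no homomorphism $G_1\to G_2$ and no homomorphism $G_2\to G_1$; (v) for all $\varphi,\psi\in\mathrm{End}(G_1)\cup\mathrm{End}(G_2)$ and all $u,v\in V(H)$: if for every $x\in V(G_1)$ the vertices $(\varphi(x),u)$ and $(\psi(x),v)$ are adjacent in $I$, then $u$ and $v$ are adjacent in $H$; (vi) for every $\varphi_H\in\mathrm{End}(H)\setminus\{\mathrm{id}_H\}$, if there exists $\varphi\in\mathrm{End}(I)$ with $\varphi(\pi_H^{ -1}(u))\subseteq\pi_H^{ -1}(\varphi_H(u))$ for every $u\in V(H)$, then there is $v\in V(H)$ with $f(v)\neq f(\varphi_H(v))$; (vii) $H$ is connected. Then there is a monoid monomorphism $\mathrm{End}(I)\to\mathrm{End}(G_1)\cap\mathrm{End}(G_2)$.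
   Context: Graphs are finite, simple, undirected; homomorphisms send edges to edges; $\mathrm{End}(G)$ is the monoid of endomorphisms. The odd girth is the length of a shortest odd cycle. For graphs $G_1,G_2$ on the same vertex set, a graph $H$ and $f:V(H)\to\{1,2\}$, the product $\mathbf G\mathbin{\underset{f}{\square}}H$ has vertex set $V(G_1)\times V(H)$, with $(x,u)$ and $(y,v)$ adjacent iff either $x=y$ and $\{u,v\}\in E(H)$, or $u=v$ and $\{x,y\}\in E(G_{f(u)})$. $\pi_H:(x,u)\mapsto u$ is the projection to $V(H)$, and $\pi_H(e)$ for an edge $e$ denotes the set of images of its endpoints. $\mathrm{End}(G_1)\cap\mathrm{End}(G_2)$ is the monoid of maps $V(G_1)\to V(G_1)$ that are endomorphisms of both. -}

module Defs where

open import Level using (0ℓ)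
open import Data.Nat using (ℕ; suc; _≤_; _<_)
open import Data.Nat.DivMod using (_mod_)
open import Data.Fin using (Fin; toℕ)
open import Data.Product using (Σ; ∃; _×_; _,_; proj₁; proj₂)
open import Data.Sum using (_⊎_)
open import Data.Empty using (⊥)
open import Relation.Nullary using (¬_; Dec)
open import Relation.Binary.PropositionalEquality using (_≡_; refl)
open import Relation.Binary.Construct.Closure.ReflexiveTransitive using (Star)
open import Function using (_∘_; id)
open import Function.Definitions using (Injective)
open import Algebra.Bundles using (RawMonoid)
open import Algebra.Morphism.Structures using (module MonoidMorphisms)

-- Simple undirected graphs on a vertex type V (finite: V will be Fin n
-- or a product of such).

record Graph (V : Set) : Set₁ where
  field
    _~_    : V → V → Set
    sym    : ∀ {x y} → x ~ y → y ~ x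
    irrefl : ∀ {x} → ¬ (x ~ x)
    dec    : ∀ x y → Dec (x ~ y)
open Graph public

Hom : ∀ {V W} → Graph V → Graph W → (V → W) → Set
Hom G K h = ∀ {x y} → _~_ G x y → _~_ K (h x) (h y)

End : ∀ {V} → Graph V → Set
End {V} G = Σ (V → V) (Hom G G)

Connected : ∀ {V} → (V → V → Set) → Set
Connected {V} R = ∀ (x y : V) → Star R x y

next : ∀ {k} → Fin k → Fin k
next {suc k} i = suc (toℕ i) mod suc k

record Cycle {V : Set} (G : Graph V) (k : ℕ) : Set where
  field
    len≥3 : 3 ≤ k
    vtx   : Fin k → V
    inj   : Injective _≡_ _≡_ vtx
    adj   : ∀ i → _~_ G (vtx i) (vtx (next i))
open Cycle public

data Odd : ℕ → Set where
  odd1  : Odd 1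
  odd+2 : ∀ {n} → Odd n → Odd (suc (suc n))

OddGirth : ∀ {V} → Graph V → ℕ → Set
OddGirth G k = Odd k × Cycle G k × (∀ j → Odd j → Cycle G j → k ≤ j)

-- same odd girth (including the case where both are infinite, i.e. no
-- odd cycles at all)
SameOddGirth : ∀ {V W} → Graph V → Graph W → Set
SameOddGirth G K = ∀ k → (OddGirth G k → OddGirth K k) × (OddGirth K k → OddGirth G k)

EdgeOf : ∀ {V} {G : Graph V} {k} → Cycle G k → V → V → Set
EdgeOf C x y = ∃ λ i → (vtx C i ≡ x × vtx C (next i) ≡ y) ⊎ (vtx C i ≡ y × vtx C (next i) ≡ x)

ShortOddAdj : ∀ {V} → Graph V → V → V → Set
ShortOddAdj G x y = ∃ λ k → OddGirth G k × Σ (Cycle G k) λ C → EdgeOf C x y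

ShortOddSpanningConnected : ∀ {V} → Graph V → Set
ShortOddSpanningConnected {V} G =
  (∀ (x : V) → ∃ λ k → OddGirth G k × Σ (Cycle G k) λ C → ∃ λ i → vtx C i ≡ x)
  × Connected (ShortOddAdj G)

ProdAdj : ∀ {V W} → (Fin 2 → Graph V) → Graph W → (W → Fin 2) →
          V × W → V × W → Set
ProdAdj Gs H f (x , u) (y , v) =
  (x ≡ y × _~_ H u v) ⊎ (u ≡ v × _~_ (Gs (f u)) x y)

pair : ∀ {V} → Graph V → Graph V → Fin 2 → Graph V
pair G₁ G₂ Fin.zero = G₁
pair G₁ G₂ (Fin.suc _) = G₂

EndMonoid : ∀ {V} → Graph V → RawMonoid 0ℓ 0ℓ
EndMonoid {V} G = record
  { Carrier = End G
  ; _≈_ = λ φ ψ → ∀ x → proj₁ φ x ≡ proj₁ ψ x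
  ; _∙_ = λ φ ψ → (proj₁ φ ∘ proj₁ ψ) , (λ e → proj₂ φ (proj₂ ψ e))
  ; ε = id , (λ e → e)
  }

End∩ : ∀ {V} → Graph V → Graph V → Set
End∩ {V} G₁ G₂ = Σ (V → V) λ φ → Hom G₁ G₁ φ × Hom G₂ G₂ φ

End∩Monoid : ∀ {V} → Graph V → Graph V → RawMonoid 0ℓ 0ℓ
End∩Monoid {V} G₁ G₂ = record
  { Carrier = End∩ G₁ G₂
  ; _≈_ = λ φ ψ → ∀ x → proj₁ φ x ≡ proj₁ ψ x
  ; _∙_ = λ φ ψ → (proj₁ φ ∘ proj₁ ψ)
                  , (λ e → proj₁ (proj₂ φ) (proj₁ (proj₂ ψ) e))
                  , (λ e → proj₂ (proj₂ φ) (proj₂ (proj₂ ψ) e))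
  ; ε = id , (λ e → e) , (λ e → e)
  }

IsMonoidMono : (M N : RawMonoid 0ℓ 0ℓ) → (RawMonoid.Carrier M → RawMonoid.Carrier N) → Set
IsMonoidMono M N = MonoidMorphisms.IsMonoidMonomorphism M N

{-# OPTIONS --safe #-}
-- Let g be the common odd girth of G₁ and G₂. A shortest odd cycle of I lies in one
-- fibre by (i), so it is an odd cycle of some Gᵢ; hence every odd closed walk of I
-- has length at least g. An endomorphism φ of I therefore maps a shortest odd cycle
-- of a fibre G_{f(u)} × {u} to a shortest odd cycle of I, which lies in one fibre;
-- since these cycles form a connected spanning subgraph, φ maps each fibre into a
-- fibre. This yields φ_H : V(H) → V(H) and fibre maps G_{f(u)} → G_{f(φ_H u)}, so
-- f ∘ φ_H = f by (iv), φ_H ∈ End(H) by (v), and φ_H = id by (vi). By (iii) the fibre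
-- maps of adjacent fibres coincide, so by (vii) φ = ψ × id for a single
-- ψ ∈ End(G₁) ∩ End(G₂), and φ ↦ ψ is the required monomorphism.
module Submission where

open import Defs hiding (sym)
open import Data.Nat using (ℕ; zero; suc; _+_; _∸_; _≤_; _<_; _≤?_; z≤n; s≤s)
open import Data.Nat.Properties
open import Data.Nat.DivMod using (_mod_; _%_; n%n≡0; m<n⇒m%n≡m; m%n<n)
open import Data.Nat.Induction using (<-rec)
open import Data.Fin using (Fin; zero; suc; toℕ; fromℕ<)
open import Data.Fin.Properties using (toℕ-injective; toℕ-fromℕ<; fromℕ<-cong; toℕ<n; any?; all?)
  renaming (_≟_ to _≟ᶠ_)
open import Data.Product using (Σ; ∃; ∃₂; _×_; _,_; proj₁; proj₂)
open import Data.Product.Properties using (×-≡,≡→≡; ≡-dec)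
open import Data.Sum as Sum using (_⊎_; inj₁; inj₂)
open import Data.Empty using (⊥-elim)
open import Function using (_∘_; id)
open import Function.Definitions using (Injective)
open import Relation.Nullary using (¬_; yes; no; contradiction)
open import Relation.Nullary.Decidable using (decidable-stable; ¬?; _×-dec_)
open import Relation.Binary.Definitions using (DecidableEquality; tri<; tri≈; tri>)
open import Relation.Binary.PropositionalEquality
  using (_≡_; _≢_; refl; sym; trans; cong; subst; subst₂; module ≡-Reasoning)
open import Relation.Binary.Construct.Closure.ReflexiveTransitive as Star using (Star)
open import Algebra.Bundles using (RawMonoid)

odd-+⇒odd⊎odd : ∀ m {n} → Odd (m + n) → Odd m ⊎ Odd n
odd-+⇒odd⊎odd zero          odd         = inj₂ odd
odd-+⇒odd⊎odd (suc zero)    _           = inj₁ odd1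
odd-+⇒odd⊎odd (suc (suc m)) (odd+2 odd) = Sum.map₁ odd+2 (odd-+⇒odd⊎odd m odd)

≢⇒cover : ∀ {a b : Fin 2} → a ≢ b → ∀ c → a ≡ c ⊎ b ≡ c
≢⇒cover {zero}     {zero}     a≢b _          = contradiction refl a≢b
≢⇒cover {suc zero} {suc zero} a≢b _          = contradiction refl a≢b
≢⇒cover {zero}     {suc zero} _   zero       = inj₁ refl
≢⇒cover {zero}     {suc zero} _   (suc zero) = inj₂ refl
≢⇒cover {suc zero} {zero}     _   zero       = inj₂ refl
≢⇒cover {suc zero} {zero}     _   (suc zero) = inj₁ refl

toℕ-mod : ∀ {i k} → i < suc k → toℕ (i mod suc k) ≡ i
toℕ-mod i<k = trans (toℕ-fromℕ< _) (m<n⇒m%n≡m i<k)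

star-invariant : ∀ {A B : Set} {R : A → A → Set} (q : A → B) →
                 (∀ {x y} → R x y → q x ≡ q y) → ∀ {x y} → Star R x y → q x ≡ q y
star-invariant q q-resp = Star.fold (λ x y → q x ≡ q y) (λ r eq → trans (q-resp r) eq) refl

injective⊎collision : ∀ {A : Set} → DecidableEquality A → ∀ {k} (c : Fin k → A) →
                      Injective _≡_ _≡_ c ⊎ ∃₂ λ a b → a ≢ b × c a ≡ c b
injective⊎collision _≟_ c with any? (λ a → any? (λ b → ¬? (a ≟ᶠ b) ×-dec (c a ≟ c b)))
... | yes (a , b , collision) = inj₂ (a , b , collision)
... | no  ¬collision          =
  inj₁ λ {a} {b} ca≡cb → decidable-stable (a ≟ᶠ b) λ a≢b → ¬collision (a , b , a≢b , ca≡cb)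

splice : ∀ {A : Set} → (ℕ → A) → ℕ → ℕ → ℕ → A
splice w a ℓ i with i ≤? a
... | yes _ = w i
... | no  _ = w (ℓ + i)

splice-≤ : ∀ {A : Set} {w : ℕ → A} {a ℓ i} → i ≤ a → splice w a ℓ i ≡ w i
splice-≤ {a = a} {i = i} i≤a with i ≤? a
... | yes _   = refl
... | no i≰a = contradiction i≤a i≰a

splice-> : ∀ {A : Set} {w : ℕ → A} {a ℓ i} → a < i → splice w a ℓ i ≡ w (ℓ + i)
splice-> {a = a} {i = i} a<i with i ≤? a
... | yes i≤a = contradiction i≤a (<⇒≱ a<i)
... | no _    = refl

mapCycle : ∀ {V W} {G : Graph V} {K : Graph W} {k} (h : V → W) (C : Cycle G k) →
           Injective _≡_ _≡_ (h ∘ vtx C) → (∀ i → _~_ K (h (vtx C i)) (h (vtx C (next i)))) →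
           Cycle K k
mapCycle h C inj adj = record { len≥3 = len≥3 C ; vtx = h ∘ vtx C ; inj = inj ; adj = adj }

module _ {V : Set} (K : Graph V) where

  -- A closed walk of length k visits w 0, …, w k; the other values of w are irrelevant.
  ClosedWalk : ℕ → (ℕ → V) → Set
  ClosedWalk k w = w 0 ≡ w k × (∀ i → i < k → _~_ K (w i) (w (suc i)))

  CyclicWalk : (k : ℕ) → (Fin k → V) → Set
  CyclicWalk k c = ∀ i → _~_ K (c i) (c (next i))

  OddCyclesAtLeast : ℕ → Set
  OddCyclesAtLeast g = ∀ j → Odd j → Cycle K j → g ≤ j

  ShorterOddClosedWalk : ℕ → Set
  ShorterOddClosedWalk k = ∃ λ j → j < k × Odd j × ∃ (ClosedWalk j)

  oddClosedWalk⇒3≤ : ∀ {k w} → Odd k → ClosedWalk k w → 3 ≤ k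
  oddClosedWalk⇒3≤ {w = w} odd1 (closed , step) =
    ⊥-elim (irrefl K (subst (_~_ K (w 0)) (sym closed) (step 0 (s≤s z≤n))))
  oddClosedWalk⇒3≤ (odd+2 odd1)       _ = s≤s (s≤s (s≤s z≤n))
  oddClosedWalk⇒3≤ (odd+2 (odd+2 _)) _ = s≤s (s≤s (s≤s z≤n))

  closedWalk-mod : ∀ {k w} → ClosedWalk (suc k) w → ∀ {j} → j ≤ suc k → w (j % suc k) ≡ w j
  closedWalk-mod {k} {w} (closed , _) j≤k with m≤n⇒m<n∨m≡n j≤k
  ... | inj₁ j<k  = cong w (m<n⇒m%n≡m j<k)
  ... | inj₂ refl = trans (cong w (n%n≡0 (suc k))) closed

  closedWalk⇒cyclicWalk : ∀ {k w} → ClosedWalk k w → CyclicWalk k (w ∘ toℕ)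
  closedWalk⇒cyclicWalk {suc k} {w} walk@(_ , step) i =
    subst (_~_ K (w (toℕ i))) (sym w-next) (step (toℕ i) (toℕ<n i))
    where
    w-next : w (toℕ (next i)) ≡ w (suc (toℕ i))
    w-next = trans (cong w (toℕ-fromℕ< _)) (closedWalk-mod walk (toℕ<n i))

  cyclicWalk⇒closedWalk : ∀ {k c} → CyclicWalk (suc k) c → ClosedWalk (suc k) (c ∘ (_mod suc k))
  cyclicWalk⇒closedWalk {k} {c} walk =
    cong c (fromℕ<-cong _ _ (sym (n%n≡0 (suc k))) (m%n<n 0 (suc k)) (m%n<n (suc k) (suc k))) ,
    λ i i<k → subst (_~_ K (c (i mod suc k))) (cong c (next-mod i<k)) (walk (i mod suc k))
    where
    next-mod : ∀ {i} → i < suc k → next (i mod suc k) ≡ suc i mod suc k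
    next-mod {i} i<k = fromℕ<-cong _ _ (cong (λ j → suc j % suc k) (toℕ-mod i<k))
                         (m%n<n (suc (toℕ (i mod suc k))) (suc k)) (m%n<n (suc i) (suc k))

  loop-closedWalk : ∀ {k w} a b → a ≤ b → b ≤ k → w a ≡ w b → ClosedWalk k w →
                    ClosedWalk (b ∸ a) (w ∘ (a +_))
  loop-closedWalk {w = w} a b a≤b b≤k wa≡wb (_ , step) = closed , loop-step
    where
    a+ℓ≡b : a + (b ∸ a) ≡ b
    a+ℓ≡b = m+[n∸m]≡n a≤b
    closed : w (a + 0) ≡ w (a + (b ∸ a))
    closed = trans (cong w (+-identityʳ a)) (trans wa≡wb (cong w (sym a+ℓ≡b)))
    loop-step : ∀ i → i < b ∸ a → _~_ K (w (a + i)) (w (a + suc i))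
    loop-step i i<ℓ = subst (_~_ K (w (a + i))) (cong w (sym (+-suc a i)))
      (step (a + i) (<-≤-trans (subst (a + i <_) a+ℓ≡b (+-monoʳ-< a i<ℓ)) b≤k))

  skipLoop-closedWalk : ∀ {k w} a b → a ≤ b → b < k → w a ≡ w b → ClosedWalk k w →
                        ClosedWalk (k ∸ (b ∸ a)) (splice w a (b ∸ a))
  skipLoop-closedWalk {k} {w} a b a≤b b<k wa≡wb (closed , step) = rest-closed , rest-step
    where
    ℓ m : ℕ
    ℓ = b ∸ a
    m = k ∸ ℓ
    rest = splice w a ℓ

    rest-≤ : ∀ {i} → i ≤ a → rest i ≡ w i
    rest-≤ = splice-≤ {w = w} {a} {ℓ}
    rest-> : ∀ {i} → a < i → rest i ≡ w (ℓ + i)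
    rest-> = splice-> {w = w} {a} {ℓ}

    a+ℓ≡b : a + ℓ ≡ b
    a+ℓ≡b = m+[n∸m]≡n a≤b
    ℓ+m≡k : ℓ + m ≡ k
    ℓ+m≡k = m+[n∸m]≡n (≤-trans (m∸n≤m b a) (<⇒≤ b<k))
    a<m : a < m
    a<m = +-cancelʳ-< ℓ a m (subst₂ _<_ (sym a+ℓ≡b) (trans (sym ℓ+m≡k) (+-comm ℓ m)) b<k)

    rest-closed : rest 0 ≡ rest m
    rest-closed = begin
      rest 0         ≡⟨ rest-≤ z≤n ⟩
      w 0            ≡⟨ closed ⟩
      w k            ≡⟨ cong w (sym ℓ+m≡k) ⟩
      w (ℓ + m)      ≡⟨ sym (rest-> a<m) ⟩
      rest m         ∎
      where open ≡-Reasoning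

    rest-step : ∀ i → i < m → _~_ K (rest i) (rest (suc i))
    rest-step i i<m with <-cmp i a
    ... | tri< i<a _ _ = subst₂ (_~_ K) (sym (rest-≤ (<⇒≤ i<a))) (sym (rest-≤ i<a))
                           (step i (<-trans i<a (≤-<-trans a≤b b<k)))
    ... | tri≈ _ refl _ = subst₂ (_~_ K) (sym (trans (rest-≤ ≤-refl) wa≡wb))
                            (sym (trans (rest-> (n<1+n a)) (cong w ℓ+1+a≡1+b))) (step b b<k)
      where
      ℓ+1+a≡1+b : ℓ + suc a ≡ suc b
      ℓ+1+a≡1+b = trans (+-suc ℓ a) (cong suc (trans (+-comm ℓ a) a+ℓ≡b))
    ... | tri> _ _ a<i = subst₂ (_~_ K) (sym (rest-> a<i))
                           (sym (trans (rest-> (<-trans a<i (n<1+n i))) (cong w (+-suc ℓ i))))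
                           (step (ℓ + i) (subst (ℓ + i <_) ℓ+m≡k (+-monoʳ-< ℓ i<m)))

  -- The loop a … b and the rest of the walk have lengths adding up to k, so one is odd.
  shortcut : ∀ {k w} a b → a < b → b < k → w a ≡ w b → Odd k → ClosedWalk k w →
             ShorterOddClosedWalk k
  shortcut {k} a b a<b b<k wa≡wb odd walk =
    Sum.[ (λ odd-ℓ → ℓ , ℓ<k , odd-ℓ , _ , loop-closedWalk a b a≤b (<⇒≤ b<k) wa≡wb walk)
        , (λ odd-m → k ∸ ℓ , m<k , odd-m , _ , skipLoop-closedWalk a b a≤b b<k wa≡wb walk) ]′
      (odd-+⇒odd⊎odd ℓ (subst Odd (sym (m+[n∸m]≡n (<⇒≤ ℓ<k))) odd))
    where
    ℓ = b ∸ a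
    a≤b = <⇒≤ a<b
    ℓ<k : ℓ < k
    ℓ<k = ≤-<-trans (m∸n≤m b a) b<k
    m<k : k ∸ ℓ < k
    m<k = ∸-monoʳ-< (m<n⇒0<n∸m a<b) (<⇒≤ ℓ<k)

  shortcutFin : ∀ {k w} {a b : Fin k} → a ≢ b → w (toℕ a) ≡ w (toℕ b) → Odd k →
                ClosedWalk k w → ShorterOddClosedWalk k
  shortcutFin {a = a} {b} a≢b eq with <-cmp (toℕ a) (toℕ b)
  ... | tri< a<b _ _ = shortcut _ _ a<b (toℕ<n b) eq
  ... | tri≈ _ a≡b _ = contradiction (toℕ-injective a≡b) a≢b
  ... | tri> _ _ b<a = shortcut _ _ b<a (toℕ<n a) (sym eq)

  -- A shortest odd cycle of length below g would contradict the hypothesis.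
  oddGirth≥⇒oddCyclesAtLeast : ∀ {g} → (∀ k → OddGirth K k → g ≤ k) → OddCyclesAtLeast g
  oddGirth≥⇒oddCyclesAtLeast {g} shortest≥g = <-rec _ go
    where
    go : ∀ k → (∀ {j} → j < k → Odd j → Cycle K j → g ≤ j) → Odd k → Cycle K k → g ≤ k
    go k shorter≥g odd C = decidable-stable (g ≤? k) λ g≰k →
      g≰k (shortest≥g k (odd , C , λ j odd-j C-j → decidable-stable (k ≤? j) λ k≰j →
        g≰k (≤-trans (shorter≥g (≰⇒> k≰j) odd-j C-j) (<⇒≤ (≰⇒> k≰j)))))

  module _ (_≟_ : DecidableEquality V) where

    oddClosedWalk-atLeast : ∀ {g} → OddCyclesAtLeast g →
                            ∀ k {w} → Odd k → ClosedWalk k w → g ≤ k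
    oddClosedWalk-atLeast {g} cycles≥g = <-rec _ go
      where
      go : ∀ k → (∀ {j} → j < k → ∀ {w} → Odd j → ClosedWalk j w → g ≤ j) →
           ∀ {w} → Odd k → ClosedWalk k w → g ≤ k
      go k shorter≥g {w} odd walk with injective⊎collision _≟_ (w ∘ toℕ)
      ... | inj₁ inj = cycles≥g k odd (record
        { len≥3 = oddClosedWalk⇒3≤ odd walk
        ; vtx = w ∘ toℕ
        ; inj = inj
        ; adj = closedWalk⇒cyclicWalk walk
        })
      ... | inj₂ (_ , _ , a≢b , eq) =
        let (j , j<k , odd-j , _ , walk-j) = shortcutFin a≢b eq odd walk
        in ≤-trans (shorter≥g j<k odd-j walk-j) (<⇒≤ j<k)

    shortestOddCyclicWalk-injective : ∀ {k c} → OddCyclesAtLeast k → Odd k → CyclicWalk k c →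
                                      Injective _≡_ _≡_ c
    shortestOddCyclicWalk-injective {suc k} {c} cycles≥k odd walk {a} {b} ca≡cb =
      decidable-stable (a ≟ᶠ b) λ a≢b →
        let (j , j<k , odd-j , _ , walk-j) =
              shortcutFin a≢b eq odd (cyclicWalk⇒closedWalk walk)
        in <⇒≱ j<k (oddClosedWalk-atLeast cycles≥k j odd-j walk-j)
      where
      mod-toℕ : ∀ i → toℕ i mod suc k ≡ i
      mod-toℕ i = toℕ-injective (toℕ-mod (toℕ<n i))
      eq : c (toℕ a mod suc k) ≡ c (toℕ b mod suc k)
      eq = trans (cong c (mod-toℕ a)) (trans ca≡cb (sym (cong c (mod-toℕ b))))

productEndo⇒monoidMono : ∀ {V W} (G₁ G₂ : Graph V) (I : Graph (V × W)) → W →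
  (F : End I → End∩ G₁ G₂) → (∀ φ x u → proj₁ φ (x , u) ≡ (proj₁ (F φ) x , u)) →
  IsMonoidMono (EndMonoid I) (End∩Monoid G₁ G₂) F
productEndo⇒monoidMono _ _ I u₀ F F-spec = record
  { isMonoidHomomorphism = record
    { isMagmaHomomorphism = record
      { isRelHomomorphism = record
        { cong = λ {φ} {φ′} φ≈φ′ x →
            trans (F-at φ x) (trans (cong proj₁ (φ≈φ′ (x , u₀))) (sym (F-at φ′ x)))
        }
      ; homo = homo
      }
    ; ε-homo = F-at (id , id)
    }
  ; injective = λ {φ} {φ′} Fφ≈Fφ′ (x , u) →
      trans (F-spec φ x u) (trans (cong (_, u) (Fφ≈Fφ′ x)) (sym (F-spec φ′ x u)))
  }
  where
  open ≡-Reasoning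
  F-at : ∀ φ x → proj₁ (F φ) x ≡ proj₁ (proj₁ φ (x , u₀))
  F-at φ x = cong proj₁ (sym (F-spec φ x u₀))
  open RawMonoid (EndMonoid I) using (_∙_)
  homo : ∀ φ φ′ x → proj₁ (F (φ ∙ φ′)) x ≡ proj₁ (F φ) (proj₁ (F φ′) x)
  homo φ φ′ x = begin
    proj₁ (F (φ ∙ φ′)) x                 ≡⟨ F-at (φ ∙ φ′) x ⟩
    proj₁ (proj₁ φ (proj₁ φ′ (x , u₀)))  ≡⟨ cong (proj₁ ∘ proj₁ φ) (F-spec φ′ x u₀) ⟩
    proj₁ (proj₁ φ (proj₁ (F φ′) x , u₀)) ≡⟨ sym (F-at φ _) ⟩
    proj₁ (F φ) (proj₁ (F φ′) x)         ∎

module Endomorphisms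
  {n m : ℕ} (G₁ G₂ : Graph (Fin n)) (H : Graph (Fin m)) (f : Fin m → Fin 2)
  (I : Graph (Fin n × Fin m)) (x₀ : Fin n) {u₁ u₂ : Fin m} (f-nonconstant : f u₁ ≢ f u₂)
  (P⊆I : ∀ a b → ProdAdj (pair G₁ G₂) H f a b → _~_ I a b)
  (shortestOddCycles-inFibre : ∀ k → OddGirth I k → (C : Cycle I k) →
    ∀ i j → proj₂ (vtx C i) ≡ proj₂ (vtx C j))
  (sameOddGirth : SameOddGirth G₁ G₂)
  (spanning₁ : ShortOddSpanningConnected G₁)
  (spanning₂ : ShortOddSpanningConnected G₂)
  (extraEdges : ∀ a b → _~_ I a b → ¬ ProdAdj (pair G₁ G₂) H f a b →
    proj₂ a ≢ proj₂ b × ¬ _~_ H (proj₂ a) (proj₂ b))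
  (¬G₁→G₂ : ¬ Σ (Fin n → Fin n) (Hom G₁ G₂))
  (¬G₂→G₁ : ¬ Σ (Fin n → Fin n) (Hom G₂ G₁))
  (fibreMaps-adjacent : ∀ (φ ψ : Fin n → Fin n) → (Hom G₁ G₁ φ ⊎ Hom G₂ G₂ φ) →
    (Hom G₁ G₁ ψ ⊎ Hom G₂ G₂ ψ) → ∀ u v → (∀ x → _~_ I (φ x , u) (ψ x , v)) → _~_ H u v)
  (nonIdentity-changes-f : ∀ (φH : Fin m → Fin m) → Hom H H φH → ¬ (∀ u → φH u ≡ u) →
    (∃ λ (φ : Fin n × Fin m → Fin n × Fin m) →
       Hom I I φ × (∀ x u → proj₂ (φ (x , u)) ≡ φH u)) →
    ∃ λ v → f v ≢ f (φH v))
  (H-connected : Connected (_~_ H))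
  where

  𝐆 : Fin 2 → Graph (Fin n)
  𝐆 = pair G₁ G₂

  g : ℕ
  g = proj₁ (proj₁ spanning₁ x₀)

  𝐆-oddGirth : ∀ c → OddGirth (𝐆 c) g
  𝐆-oddGirth zero       = proj₁ (proj₂ (proj₁ spanning₁ x₀))
  𝐆-oddGirth (suc zero) = proj₁ (sameOddGirth g) (𝐆-oddGirth zero)

  𝐆-shortOddConnected : ∀ c → Connected (ShortOddAdj (𝐆 c))
  𝐆-shortOddConnected zero       = proj₂ spanning₁
  𝐆-shortOddConnected (suc zero) = proj₂ spanning₂

  𝐆-rigid : ∀ {a b h} → Hom (𝐆 a) (𝐆 b) h → a ≡ b
  𝐆-rigid {zero}     {zero}     _   = refl
  𝐆-rigid {zero}     {suc zero} hom = ⊥-elim (¬G₁→G₂ (_ , hom))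
  𝐆-rigid {suc zero} {zero}     hom = ⊥-elim (¬G₂→G₁ (_ , hom))
  𝐆-rigid {suc zero} {suc zero} _   = refl

  𝐆-End : ∀ c {h} → Hom (𝐆 c) (𝐆 c) h → Hom G₁ G₁ h ⊎ Hom G₂ G₂ h
  𝐆-End zero       = inj₁
  𝐆-End (suc zero) = inj₂

  f-onto : ∀ c → ∃ λ u → f u ≡ c
  f-onto c = Sum.[ (u₁ ,_) , (u₂ ,_) ]′ (≢⇒cover f-nonconstant c)

  fibreEdge : ∀ {a b u} → _~_ I a b → proj₂ a ≡ u → proj₂ b ≡ u →
              _~_ (𝐆 (f u)) (proj₁ a) (proj₁ b)
  fibreEdge {x , _} {y , _} e refl refl = decidable-stable (dec (𝐆 _) x y) λ ¬xy →
    proj₁ (extraEdges _ _ e Sum.[ (λ (_ , uu) → irrefl H uu) , (λ (_ , xy) → ¬xy xy) ]′) refl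

  adjacentFibres-sameVertex : ∀ {a b} → _~_ I a b → _~_ H (proj₂ a) (proj₂ b) →
                              proj₁ a ≡ proj₁ b
  adjacentFibres-sameVertex {x , u} {y , v} e uv = decidable-stable (x ≟ᶠ y) λ x≢y →
    proj₂ (extraEdges _ _ e Sum.[ (λ (x≡y , _) → x≢y x≡y)
                                , (λ (u≡v , _) → irrefl H (subst (_~_ H u) (sym u≡v) uv)) ]′) uv

  fibreCycle : ∀ {k u} (C : Cycle I k) → (∀ i → proj₂ (vtx C i) ≡ u) → Cycle (𝐆 (f u)) k
  fibreCycle C inFibre = mapCycle proj₁ C
    (λ {i} {j} eq → inj C (×-≡,≡→≡ (eq , trans (inFibre i) (sym (inFibre j)))))
    (λ i → fibreEdge (adj C i) (inFibre i) (inFibre (next i)))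

  I-oddCycles≥g : OddCyclesAtLeast I g
  I-oddCycles≥g = oddGirth≥⇒oddCyclesAtLeast I λ k og@(odd , C , _) →
    let i₀ = fromℕ< (≤-trans (s≤s z≤n) (len≥3 C))
    in proj₂ (proj₂ (𝐆-oddGirth _)) k odd
         (fibreCycle C λ i → shortestOddCycles-inFibre k og C i i₀)

  module Decomposition (φ : End I) where
    open Σ φ renaming (proj₁ to h; proj₂ to h-hom)

    shortestOddCycle-image-inFibre : ∀ {u k} → OddGirth (𝐆 (f u)) k →
      (C : Cycle (𝐆 (f u)) k) → ∀ i j → proj₂ (h (vtx C i , u)) ≡ proj₂ (h (vtx C j , u))
    shortestOddCycle-image-inFibre {u} {k} (odd , _ , k-shortest) C =
      shortestOddCycles-inFibre k (odd , image , I-oddCycles≥k) image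
      where
      walk : CyclicWalk I k (λ i → h (vtx C i , u))
      walk i = h-hom (P⊆I _ _ (inj₂ (refl , adj C i)))
      I-oddCycles≥k : OddCyclesAtLeast I k
      I-oddCycles≥k j odd-j C-j = ≤-trans
        (k-shortest g (proj₁ (𝐆-oddGirth (f u))) (proj₁ (proj₂ (𝐆-oddGirth (f u)))))
        (I-oddCycles≥g j odd-j C-j)
      image : Cycle I k
      image = mapCycle (λ x → h (x , u)) C
        (shortestOddCyclicWalk-injective I (≡-dec _≟ᶠ_ _≟ᶠ_) I-oddCycles≥k odd walk) walk

    hᴴ : Fin m → Fin m
    hᴴ u = proj₂ (h (x₀ , u))

    hᵤ : Fin m → Fin n → Fin n
    hᵤ u x = proj₁ (h (x , u))

    h-mapsFibre : ∀ x u → proj₂ (h (x , u)) ≡ hᴴ u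
    h-mapsFibre x u = sym (star-invariant (λ y → proj₂ (h (y , u))) shortOddEdge
                                          (𝐆-shortOddConnected (f u) x₀ x))
      where
      shortOddEdge : ∀ {y z} → ShortOddAdj (𝐆 (f u)) y z →
                     proj₂ (h (y , u)) ≡ proj₂ (h (z , u))
      shortOddEdge (_ , og , C , i , inj₁ (refl , refl)) =
        shortestOddCycle-image-inFibre og C i (next i)
      shortOddEdge (_ , og , C , i , inj₂ (refl , refl)) =
        shortestOddCycle-image-inFibre og C (next i) i

    h-split : ∀ x u → h (x , u) ≡ (hᵤ u x , hᴴ u)
    h-split x u = cong (hᵤ u x ,_) (h-mapsFibre x u)

    hᵤ-hom : ∀ u → Hom (𝐆 (f u)) (𝐆 (f (hᴴ u))) (hᵤ u)
    hᵤ-hom u e =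
      fibreEdge (h-hom (P⊆I _ _ (inj₂ (refl , e)))) (h-mapsFibre _ u) (h-mapsFibre _ u)

    f∘hᴴ≗f : ∀ u → f (hᴴ u) ≡ f u
    f∘hᴴ≗f u = sym (𝐆-rigid (hᵤ-hom u))

    hᵤ-endo : ∀ u → Hom (𝐆 (f u)) (𝐆 (f u)) (hᵤ u)
    hᵤ-endo u = subst (λ c → Hom (𝐆 (f u)) (𝐆 c) (hᵤ u)) (f∘hᴴ≗f u) (hᵤ-hom u)

    hᴴ-hom : Hom H H hᴴ
    hᴴ-hom {u} {v} e =
      fibreMaps-adjacent (hᵤ u) (hᵤ v) (𝐆-End (f u) (hᵤ-endo u)) (𝐆-End (f v) (hᵤ-endo v))
        (hᴴ u) (hᴴ v) λ x →
          subst₂ (_~_ I) (h-split x u) (h-split x v) (h-hom (P⊆I _ _ (inj₁ (refl , e))))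

    hᴴ≗id : ∀ u → hᴴ u ≡ u
    hᴴ≗id = decidable-stable (all? λ u → hᴴ u ≟ᶠ u) λ hᴴ≢id →
      let (v , fv≢fhᴴv) = nonIdentity-changes-f hᴴ hᴴ-hom hᴴ≢id (h , h-hom , h-mapsFibre)
      in fv≢fhᴴv (sym (f∘hᴴ≗f v))

    h-fixesFibres : ∀ x u → proj₂ (h (x , u)) ≡ u
    h-fixesFibres x u = trans (h-mapsFibre x u) (hᴴ≗id u)

    hᵤ-adjacent : ∀ {u v} → _~_ H u v → ∀ x → hᵤ u x ≡ hᵤ v x
    hᵤ-adjacent {u} {v} e x = adjacentFibres-sameVertex (h-hom (P⊆I _ _ (inj₁ (refl , e))))
      (subst₂ (_~_ H) (sym (h-fixesFibres x u)) (sym (h-fixesFibres x v)) e)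

    ψ : Fin n → Fin n
    ψ = hᵤ u₁

    hᵤ≗ψ : ∀ u x → hᵤ u x ≡ ψ x
    hᵤ≗ψ u x = sym (star-invariant (λ v → hᵤ v x) (λ e → hᵤ-adjacent e x) (H-connected u₁ u))

    ψ-endo : ∀ c → Hom (𝐆 c) (𝐆 c) ψ
    ψ-endo c with u , refl ← f-onto c =
      λ e → subst₂ (_~_ (𝐆 (f u))) (hᵤ≗ψ u _) (hᵤ≗ψ u _) (hᵤ-endo u e)

  decompose : (φ : End I) → Σ (End∩ G₁ G₂) λ ψ → ∀ x u → proj₁ φ (x , u) ≡ (proj₁ ψ x , u)
  decompose φ = (ψ , ψ-endo zero , ψ-endo (suc zero)) ,
                λ x u → ×-≡,≡→≡ (hᵤ≗ψ u x , h-fixesFibres x u)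
    where open Decomposition φ

lemma4p5 : (n m : ℕ) (G₁ G₂ : Graph (Fin n)) (H : Graph (Fin m)) (f : Fin m → Fin 2)
    (I : Graph (Fin n × Fin m)) →
    -- f is non-constant
    (∃ λ u → ∃ λ v → f u ≢ f v) →
    -- P = 𝐆 □_f H is a subgraph of I
    (∀ a b → ProdAdj (pair G₁ G₂) H f a b → _~_ I a b) →
    -- (i)
    (∀ k → OddGirth I k → (C : Cycle I k) → ∀ i j → proj₂ (vtx C i) ≡ proj₂ (vtx C j)) →
    -- (ii)
    SameOddGirth G₁ G₂ →
    ShortOddSpanningConnected G₁ →
    ShortOddSpanningConnected G₂ →
    -- (iii)
    (∀ a b → _~_ I a b → ¬ ProdAdj (pair G₁ G₂) H f a b →
      proj₂ a ≢ proj₂ b × ¬ _~_ H (proj₂ a) (proj₂ b)) →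
    -- (iv)
    ¬ (Σ (Fin n → Fin n) (Hom G₁ G₂)) →
    ¬ (Σ (Fin n → Fin n) (Hom G₂ G₁)) →
    -- (v)
    (∀ (φ ψ : Fin n → Fin n) → (Hom G₁ G₁ φ ⊎ Hom G₂ G₂ φ) → (Hom G₁ G₁ ψ ⊎ Hom G₂ G₂ ψ) →
      ∀ u v → (∀ x → _~_ I (φ x , u) (ψ x , v)) → _~_ H u v) →
    -- (vi)
    (∀ (φH : Fin m → Fin m) → Hom H H φH → ¬ (∀ u → φH u ≡ u) →
      (∃ λ (φ : Fin n × Fin m → Fin n × Fin m) → Hom I I φ × (∀ x u → proj₂ (φ (x , u)) ≡ φH u)) →
      ∃ λ v → f v ≢ f (φH v)) →
    -- (vii)
    Connected (_~_ H) →
    ∃ λ (F : End I → End∩ G₁ G₂) → IsMonoidMono (EndMonoid I) (End∩Monoid G₁ G₂) F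
lemma4p5 zero _ G₁ G₂ _ _ _ _ _ _ _ _ _ _ ¬G₁→G₂ _ _ _ _ = ⊥-elim (¬G₁→G₂ (id , λ { {()} }))
lemma4p5 (suc _) _ G₁ G₂ H f I (u₁ , _ , f-nonconstant) P⊆I i ii₁ ii₂ ii₃ iii iv₁ iv₂ v vi vii =
  F , productEndo⇒monoidMono G₁ G₂ I u₁ F (λ φ → proj₂ (decompose φ))
  where
  open Endomorphisms G₁ G₂ H f I zero f-nonconstant P⊆I i ii₁ ii₂ ii₃ iii iv₁ iv₂ v vi vii
  F : End I → End∩ G₁ G₂
  F φ = proj₁ (decompose φ)
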